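{- For $n\ge1$ and $1\le j,k\le n$, \[b(n,k,j-1)-b(n,k,j)=b(n-1,k,j-1)-b(n-1,k-1,j-1).\]
   Context: $\mathcal{B}_n$ is the set of signed permutations of order $n$: bijections $\sigma$ of $\{ -n,\ldots,n\}$ with $\sigma(-i)=-\sigma(i)$, identified with $(0,\sigma_1,\ldots,\sigma_n)$; $\mathrm{des}(\sigma)$ is the number of $i\in\{1,\ldots,n\}$ with $\sigma_{i-1}>\sigma_i$ ($\sigma_0=0$). For $0\le j,k\le n$, $b(n,k,j)$ is the number of $\sigma\in\mathcal{B}_n$ with $\mathrm{des}(\sigma)=k$ such that for every $1\le i\le n$, $\sigma_i<0$ iff $|\sigma_i|\in\{1,\ldots,j\}$; $b(n,k,j)=0$ if $j$ or $k$ lies outside $\{0,\ldots,n\}$. -}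

module Defs where

open import Data.Nat using (ℕ; zero; suc; _≤ᵇ_)
open import Data.Bool using (Bool; true; false; if_then_else_; _∧_; not)
open import Data.List using (List; []; _∷_; length; map; concatMap; filterᵇ; upTo; allFin)
open import Data.Integer as ℤ using (ℤ; +_; -_; _<?_; ∣_∣)
open import Relation.Nullary.Decidable using (⌊_⌋)
open import Data.Nat.Base as ℕ using ()
open import Data.Nat.Properties as ℕP using ()

insertions : {A : Set} → A → List A → List (List A)
insertions x [] = (x ∷ []) ∷ []
insertions x (y ∷ ys) = (x ∷ y ∷ ys) ∷ map (y ∷_) (insertions x ys)

perms : {A : Set} → List A → List (List A)
perms [] = [] ∷ []
perms (x ∷ xs) = concatMap (insertions x) (perms xs)

oneTo : ℕ → List ℕ
oneTo n = map suc (upTo n)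

-- all sign vectors of length n (true = negative)
signVecs : ℕ → List (List Bool)
signVecs zero = [] ∷ []
signVecs (suc n) = concatMap (λ v → (false ∷ v) ∷ (true ∷ v) ∷ []) (signVecs n)

applySigns : List ℕ → List Bool → List ℤ
applySigns (x ∷ xs) (s ∷ ss) = (if s then - (+ x) else + x) ∷ applySigns xs ss
applySigns _ _ = []

signedPerms : ℕ → List (List ℤ)
signedPerms n = concatMap (λ p → map (applySigns p) (signVecs n)) (perms (oneTo n))

-- descents of (σ_0 = 0, σ_1, ..., σ_n): number of i ≥ 1 with σ_{i-1} > σ_i
desFrom : ℤ → List ℤ → ℕ
desFrom prev [] = zero
desFrom prev (x ∷ xs) = (if ⌊ x <? prev ⌋ then suc else (λ m → m)) (desFrom x xs)

des : List ℤ → ℕ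
des = desFrom (+ 0)

negIffLe : ℕ → ℤ → Bool
negIffLe j x = if ⌊ x <? + 0 ⌋ then (∣ x ∣ ℕ.≤ᵇ j) else not (∣ x ∣ ℕ.≤ᵇ j)

allB : {A : Set} → (A → Bool) → List A → Bool
allB p [] = true
allB p (x ∷ xs) = p x ∧ allB p xs

-- b(n,k,j); zero when j > n or k > n (negative indices are excluded by ℕ)
b : ℕ → ℕ → ℕ → ℕ
b n k j = if (j ℕ.≤ᵇ n) ∧ (k ℕ.≤ᵇ n)
          then length (filterᵇ (λ σ → (des σ ℕ.≡ᵇ k) ∧ allB (negIffLe j) σ) (signedPerms n))
          else zero

module Submission where

-- Since a σ counted by b(n,k,j) is determined by the permutation |σ| of {1,…,n}, every b(n,k,j)
-- is a descent sum D(n,j,g) = Σ g(des σ) over that permutation set, taken at g = 𝟙[· = k].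
-- Inserting the letter n+1 in all gaps of the words for n gives D(n+1,j,g) = D(n,j,M_n g) when
-- j ≤ n (the letter is the largest one) and D(n+1,n+1,g) = D(n,n,m_n g) (it is -(n+1), the
-- smallest), for explicit linear operators M_n, m_n. With Δg(d) = g(d) − g(d+1) one has
-- M_n − m_n = Δ and Δ M_{n+1} = M_n Δ, so induction on n − j yields
-- D(n+1,j,g) − D(n+1,j+1,g) = D(n,j,Δg); at g = 𝟙[· = k] this is the theorem.

open import Defs
open import Data.Nat using (ℕ; suc; _≤_; _∸_)
open import Data.Integer using (ℤ; +_; _-_)
open import Relation.Binary.PropositionalEquality using (_≡_)

open import Data.Bool using (Bool; true; false; if_then_else_; _∧_; not; T)
open import Data.Nat using (_<_; z≤n; s≤s; _≤ᵇ_; _≡ᵇ_; _≤′_; ≤′-refl; ≤′-step)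
import Data.Nat.Properties as ℕ
open import Data.Integer using (-[1+_]; _+_; _*_; 0ℤ; 1ℤ; _<?_)
import Data.Integer as ℤ
import Data.Integer.Properties as ℤ
open import Data.Integer.Tactic.RingSolver using (solve-∀)
open import Data.List using (List; []; _∷_; _++_; _∷ʳ_; length; map; concatMap; filterᵇ; upTo)
open import Data.List.Properties using (map-∘; map-cong-local; concatMap-map; concatMap-cong; map-concatMap; length-map; length-upTo; upTo-∷ʳ)
open import Data.List.Relation.Unary.All as All using (All; []; _∷_)
open import Data.List.Relation.Unary.All.Properties using (map⁺; concat⁺; applyUpTo⁺₁)
open import Data.List.Relation.Binary.Permutation.Propositional using (_↭_; ↭-refl; ↭-prep; ↭-swap; ↭-trans; ↭-sym)
open import Data.List.Relation.Binary.Permutation.Propositional.Properties using (All-resp-↭; ↭-length)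
open import Relation.Nullary using (Dec; ¬_)
open import Relation.Nullary.Decidable using (⌊_⌋; isYes≗does; dec-true; dec-false)
open import Relation.Binary.PropositionalEquality using (refl; sym; trans; cong; cong₂; subst; module ≡-Reasoning)
open import Function using (_∘_)
open import Data.Empty using (⊥-elim)

open ≡-Reasoning

∑ : {A : Set} → List A → (A → ℤ) → ℤ
∑ []       f = 0ℤ
∑ (x ∷ xs) f = f x + ∑ xs f

syntax ∑ xs (λ x → e) = ∑[ x ∈ xs ] e

module _ {A : Set} where

  ∑-++ : (xs ys : List A) (f : A → ℤ) → ∑ (xs ++ ys) f ≡ ∑ xs f + ∑ ys f
  ∑-++ []       ys f = sym (ℤ.+-identityˡ (∑ ys f))
  ∑-++ (x ∷ xs) ys f = trans (cong (_+_ (f x)) (∑-++ xs ys f)) (sym (ℤ.+-assoc (f x) _ _))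

  ∑-congᴬ : {f g : A → ℤ} {xs : List A} → All (λ x → f x ≡ g x) xs → ∑ xs f ≡ ∑ xs g
  ∑-congᴬ []       = refl
  ∑-congᴬ (e ∷ es) = cong₂ _+_ e (∑-congᴬ es)

  ∑-cong : {f g : A → ℤ} → (∀ x → f x ≡ g x) → (xs : List A) → ∑ xs f ≡ ∑ xs g
  ∑-cong e []       = refl
  ∑-cong e (x ∷ xs) = cong₂ _+_ (e x) (∑-cong e xs)

  ∑-zero : (xs : List A) → ∑[ x ∈ xs ] 0ℤ ≡ 0ℤ
  ∑-zero []       = refl
  ∑-zero (x ∷ xs) = trans (ℤ.+-identityˡ (∑[ y ∈ xs ] 0ℤ)) (∑-zero xs)

  ∑-+ : (xs : List A) (f g : A → ℤ) → ∑[ x ∈ xs ] (f x + g x) ≡ ∑ xs f + ∑ xs g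
  ∑-+ []       f g = refl
  ∑-+ (x ∷ xs) f g = trans (cong (_+_ (f x + g x)) (∑-+ xs f g)) (interchange (f x) (g x) (∑ xs f) (∑ xs g))
    where
    interchange : ∀ a b c d → (a + b) + (c + d) ≡ (a + c) + (b + d)
    interchange = solve-∀

  ∑-- : (xs : List A) (f g : A → ℤ) → ∑[ x ∈ xs ] (f x - g x) ≡ ∑ xs f - ∑ xs g
  ∑-- []       f g = refl
  ∑-- (x ∷ xs) f g = trans (cong (_+_ (f x - g x)) (∑-- xs f g)) (interchange (f x) (g x) (∑ xs f) (∑ xs g))
    where
    interchange : ∀ a b c d → (a - b) + (c - d) ≡ (a + c) - (b + d)
    interchange = solve-∀

module _ {A B : Set} where

  ∑-map : (g : A → B) (xs : List A) (f : B → ℤ) → ∑ (map g xs) f ≡ ∑ xs (f ∘ g)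
  ∑-map g []       f = refl
  ∑-map g (x ∷ xs) f = cong (_+_ (f (g x))) (∑-map g xs f)

  ∑-concatMap : (g : A → List B) (xs : List A) (f : B → ℤ) → ∑ (concatMap g xs) f ≡ ∑[ x ∈ xs ] ∑ (g x) f
  ∑-concatMap g []       f = refl
  ∑-concatMap g (x ∷ xs) f = trans (∑-++ (g x) (concatMap g xs) f) (cong (_+_ (∑ (g x) f)) (∑-concatMap g xs f))

module _ {A : Set} where

  ∑-insertions-∷ : (x y : A) (ys : List A) (f : List A → ℤ) →
                   ∑ (insertions x (y ∷ ys)) f ≡ f (x ∷ y ∷ ys) + ∑[ u ∈ insertions x ys ] f (y ∷ u)
  ∑-insertions-∷ x y ys f = cong (_+_ (f (x ∷ y ∷ ys))) (∑-map (y ∷_) (insertions x ys) f)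

  ∑-insertions-∷-∷ : (x y z : A) (zs : List A) (f : List A → ℤ) →
    ∑[ r ∈ insertions y (z ∷ zs) ] ∑ (insertions x r) f ≡
      (f (x ∷ y ∷ z ∷ zs) + f (y ∷ x ∷ z ∷ zs))
      + ((∑[ u ∈ insertions x zs ] f (y ∷ z ∷ u) + ∑[ u ∈ insertions y zs ] f (x ∷ z ∷ u))
        + ∑[ r ∈ insertions y zs ] ∑[ u ∈ insertions x r ] f (z ∷ u))
  ∑-insertions-∷-∷ x y z zs f = begin
      ∑[ r ∈ insertions y (z ∷ zs) ] ∑ (insertions x r) f
    ≡⟨ ∑-insertions-∷ y z zs (λ r → ∑ (insertions x r) f) ⟩
      ∑ (insertions x (y ∷ z ∷ zs)) f + ∑[ r ∈ insertions y zs ] ∑ (insertions x (z ∷ r)) f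
    ≡⟨ cong₂ _+_
         (trans (∑-insertions-∷ x y (z ∷ zs) f) (cong (_+_ (f (x ∷ y ∷ z ∷ zs))) (∑-insertions-∷ x z zs (f ∘ (y ∷_)))))
         (trans (∑-cong (λ r → ∑-insertions-∷ x z r f) (insertions y zs)) (∑-+ (insertions y zs) _ _)) ⟩
      (s₁ + (s₂ + t₁)) + (t₂ + t₃)
    ≡⟨ regroup s₁ s₂ t₁ t₂ t₃ ⟩
      (s₁ + s₂) + ((t₁ + t₂) + t₃) ∎
    where
    s₁ = f (x ∷ y ∷ z ∷ zs)
    s₂ = f (y ∷ x ∷ z ∷ zs)
    t₁ = ∑[ u ∈ insertions x zs ] f (y ∷ z ∷ u)
    t₂ = ∑[ u ∈ insertions y zs ] f (x ∷ z ∷ u)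
    t₃ = ∑[ r ∈ insertions y zs ] ∑[ u ∈ insertions x r ] f (z ∷ u)
    regroup : ∀ a b c d e → (a + (b + c)) + (d + e) ≡ (a + b) + ((c + d) + e)
    regroup = solve-∀

  ∑-insertions-comm : (x y : A) (q : List A) (f : List A → ℤ) →
    ∑[ r ∈ insertions y q ] ∑ (insertions x r) f ≡ ∑[ r ∈ insertions x q ] ∑ (insertions y r) f
  ∑-insertions-comm x y [] f = swap₂ (f (x ∷ y ∷ [])) (f (y ∷ x ∷ []))
    where
    swap₂ : ∀ a b → (a + (b + 0ℤ)) + 0ℤ ≡ (b + (a + 0ℤ)) + 0ℤ
    swap₂ = solve-∀
  ∑-insertions-comm x y (z ∷ zs) f = begin
      ∑[ r ∈ insertions y (z ∷ zs) ] ∑ (insertions x r) f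
    ≡⟨ ∑-insertions-∷-∷ x y z zs f ⟩
      (f xy + f yx) + ((∑[ u ∈ insertions x zs ] f (y ∷ z ∷ u) + ∑[ u ∈ insertions y zs ] f (x ∷ z ∷ u))
        + ∑[ r ∈ insertions y zs ] ∑[ u ∈ insertions x r ] f (z ∷ u))
    ≡⟨ cong₂ _+_ (ℤ.+-comm (f xy) (f yx))
                 (cong₂ _+_ (ℤ.+-comm (∑[ u ∈ insertions x zs ] f (y ∷ z ∷ u)) _)
                            (∑-insertions-comm x y zs (f ∘ (z ∷_)))) ⟩
      (f yx + f xy) + ((∑[ u ∈ insertions y zs ] f (x ∷ z ∷ u) + ∑[ u ∈ insertions x zs ] f (y ∷ z ∷ u))
        + ∑[ r ∈ insertions x zs ] ∑[ u ∈ insertions y r ] f (z ∷ u))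
    ≡⟨ sym (∑-insertions-∷-∷ y x z zs f) ⟩
      ∑[ r ∈ insertions x (z ∷ zs) ] ∑ (insertions y r) f ∎
    where
    xy = x ∷ y ∷ z ∷ zs
    yx = y ∷ x ∷ z ∷ zs

  -- perms inserts the head of its list last, whereas the recurrences below need the largest
  -- letter, the last one of upTo (suc m), to be inserted last.
  ∑-perms-∷ʳ : (l : List A) (x : A) (f : List A → ℤ) → ∑ (perms (l ∷ʳ x)) f ≡ ∑ (perms (x ∷ l)) f
  ∑-perms-∷ʳ []       x f = refl
  ∑-perms-∷ʳ (y ∷ ys) x f = begin
      ∑ (perms (y ∷ ys ∷ʳ x)) f
    ≡⟨ ∑-concatMap (insertions y) (perms (ys ∷ʳ x)) f ⟩
      ∑[ r ∈ perms (ys ∷ʳ x) ] ∑ (insertions y r) f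
    ≡⟨ ∑-perms-∷ʳ ys x (λ r → ∑ (insertions y r) f) ⟩
      ∑[ r ∈ perms (x ∷ ys) ] ∑ (insertions y r) f
    ≡⟨ ∑-concatMap (insertions x) (perms ys) (λ r → ∑ (insertions y r) f) ⟩
      ∑[ q ∈ perms ys ] ∑[ r ∈ insertions x q ] ∑ (insertions y r) f
    ≡⟨ ∑-cong (λ q → ∑-insertions-comm y x q f) (perms ys) ⟩
      ∑[ q ∈ perms ys ] ∑[ r ∈ insertions y q ] ∑ (insertions x r) f
    ≡⟨ sym (∑-concatMap (insertions y) (perms ys) (λ r → ∑ (insertions x r) f)) ⟩
      ∑[ r ∈ perms (y ∷ ys) ] ∑ (insertions x r) f
    ≡⟨ sym (∑-concatMap (insertions x) (perms (y ∷ ys)) f) ⟩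
      ∑ (perms (x ∷ y ∷ ys)) f ∎

  insertions-↭ : (x : A) (q : List A) → All (_↭ x ∷ q) (insertions x q)
  insertions-↭ x []       = ↭-refl ∷ []
  insertions-↭ x (y ∷ ys) =
    ↭-refl ∷ map⁺ (All.map (λ u↭ → ↭-trans (↭-prep y u↭) (↭-swap y x ↭-refl)) (insertions-↭ x ys))

  perms-↭ : (l : List A) → All (_↭ l) (perms l)
  perms-↭ []      = ↭-refl ∷ []
  perms-↭ (x ∷ l) =
    concat⁺ (map⁺ (All.map (λ q↭ → All.map (λ u↭ → ↭-trans u↭ (↭-prep x q↭)) (insertions-↭ x _)) (perms-↭ l)))

module _ {A B : Set} (g : A → B) where

  insertions-map : (x : A) (q : List A) → insertions (g x) (map g q) ≡ map (map g) (insertions x q)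
  insertions-map x []       = refl
  insertions-map x (y ∷ ys) = cong (_∷_ (g x ∷ g y ∷ map g ys)) (begin
      map (g y ∷_) (insertions (g x) (map g ys))
    ≡⟨ cong (map (g y ∷_)) (insertions-map x ys) ⟩
      map (g y ∷_) (map (map g) (insertions x ys))
    ≡⟨ sym (map-∘ (insertions x ys)) ⟩
      map (map g ∘ (y ∷_)) (insertions x ys)
    ≡⟨ map-∘ (insertions x ys) ⟩
      map (map g) (map (y ∷_) (insertions x ys)) ∎)

  perms-map : (l : List A) → perms (map g l) ≡ map (map g) (perms l)
  perms-map []      = refl
  perms-map (x ∷ l) = begin
      concatMap (insertions (g x)) (perms (map g l))
    ≡⟨ cong (concatMap (insertions (g x))) (perms-map l) ⟩
      concatMap (insertions (g x)) (map (map g) (perms l))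
    ≡⟨ concatMap-map (insertions (g x)) (map g) (perms l) ⟩
      concatMap (insertions (g x) ∘ map g) (perms l)
    ≡⟨ concatMap-cong (insertions-map x) (perms l) ⟩
      concatMap (map (map g) ∘ insertions x) (perms l)
    ≡⟨ sym (map-concatMap (map g) (insertions x) (perms l)) ⟩
      map (map g) (concatMap (insertions x) (perms l)) ∎

⌊⌋-true : {P : Set} (p? : Dec P) → P → ⌊ p? ⌋ ≡ true
⌊⌋-true p? p = trans (isYes≗does p?) (dec-true p? p)

⌊⌋-false : {P : Set} (p? : Dec P) → ¬ P → ⌊ p? ⌋ ≡ false
⌊⌋-false p? ¬p = trans (isYes≗does p?) (dec-false p? ¬p)

-- Written exactly as the step of desFrom, so that desFrom prev (y ∷ t) reduces to
-- descentStep ⌊ y <? prev ⌋ (desFrom y t).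
descentStep : Bool → ℕ → ℕ
descentStep β = if β then suc else λ d → d

desFrom≤length : ∀ prev s → desFrom prev s ≤ length s
desFrom≤length prev []      = z≤n
desFrom≤length prev (y ∷ s) with ⌊ y <? prev ⌋
... | true  = s≤s (desFrom≤length y s)
... | false = ℕ.m≤n⇒m≤1+n (desFrom≤length y s)

-- Inserting the largest letter into a word (preceded by 0) of length L with d descents keeps d
-- descents in the d+1 gaps that follow a descent top or end the word, and adds one in the other
-- L−d gaps; the smallest letter keeps d descents exactly in the d gaps inside a descent.
maxInsertion : ℕ → (ℕ → ℤ) → ℕ → ℤ
maxInsertion L g d = (+ d + 1ℤ) * g d + (+ L - + d) * g (suc d)

minInsertion : ℕ → (ℕ → ℤ) → ℕ → ℤ
minInsertion L g d = + d * g d + (+ L + 1ℤ - + d) * g (suc d)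

maxInsertion-∷ : ∀ β g L d → g (suc d) + maxInsertion L (g ∘ descentStep β) d ≡ maxInsertion (suc L) g (descentStep β d)
maxInsertion-∷ true  g L d = identity (+ d) (+ L) (g (suc d)) (g (suc (suc d)))
  where
  identity : ∀ d L a b → a + ((d + 1ℤ) * a + (L - d) * b) ≡ ((1ℤ + d) + 1ℤ) * a + ((1ℤ + L) - (1ℤ + d)) * b
  identity = solve-∀
maxInsertion-∷ false g L d = identity (+ d) (+ L) (g d) (g (suc d))
  where
  identity : ∀ d L a b → b + ((d + 1ℤ) * a + (L - d) * b) ≡ (d + 1ℤ) * a + ((1ℤ + L) - d) * b
  identity = solve-∀

minInsertion-∷ : ∀ β g L d → g (suc d) + minInsertion L (g ∘ descentStep β) d ≡ minInsertion (suc L) g (descentStep β d)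
minInsertion-∷ true  g L d = identity (+ d) (+ L) (g (suc d)) (g (suc (suc d)))
  where
  identity : ∀ d L a b → a + (d * a + (L + 1ℤ - d) * b) ≡ (1ℤ + d) * a + ((1ℤ + L) + 1ℤ - (1ℤ + d)) * b
  identity = solve-∀
minInsertion-∷ false g L d = identity (+ d) (+ L) (g d) (g (suc d))
  where
  identity : ∀ d L a b → b + (d * a + (L + 1ℤ - d) * b) ≡ d * a + ((1ℤ + L) + 1ℤ - d) * b
  identity = solve-∀

∑-insertions-max : ∀ (g : ℕ → ℤ) prev v s → prev ℤ.< v → All (ℤ._< v) s →
  ∑[ u ∈ insertions v s ] g (desFrom prev u) ≡ maxInsertion (length s) g (desFrom prev s)
∑-insertions-max g prev v [] prev<v [] rewrite ⌊⌋-false (v <? prev) (ℤ.<-asym prev<v) = identity (g 0) (g 1)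
  where
  identity : ∀ a b → a + 0ℤ ≡ (0ℤ + 1ℤ) * a + (0ℤ - 0ℤ) * b
  identity = solve-∀
∑-insertions-max g prev v (y ∷ ys) prev<v (y<v ∷ ys<v) = begin
    ∑[ u ∈ insertions v (y ∷ ys) ] g (desFrom prev u)
  ≡⟨ ∑-insertions-∷ v y ys (g ∘ desFrom prev) ⟩
    g (desFrom prev (v ∷ y ∷ ys)) + ∑[ u ∈ insertions v ys ] g (descentStep β (desFrom y u))
  ≡⟨ cong₂ _+_ (cong g new-descent) (∑-insertions-max (g ∘ descentStep β) y v ys y<v ys<v) ⟩
    g (suc d) + maxInsertion (length ys) (g ∘ descentStep β) d
  ≡⟨ maxInsertion-∷ β g (length ys) d ⟩
    maxInsertion (suc (length ys)) g (descentStep β d) ∎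
  where
  β = ⌊ y <? prev ⌋
  d = desFrom y ys
  new-descent : desFrom prev (v ∷ y ∷ ys) ≡ suc d
  new-descent rewrite ⌊⌋-false (v <? prev) (ℤ.<-asym prev<v) | ⌊⌋-true (y <? v) y<v = refl

∑-insertions-min : ∀ (g : ℕ → ℤ) prev v s → v ℤ.< prev → All (v ℤ.<_) s →
  ∑[ u ∈ insertions v s ] g (desFrom prev u) ≡ minInsertion (length s) g (desFrom prev s)
∑-insertions-min g prev v [] v<prev [] rewrite ⌊⌋-true (v <? prev) v<prev = identity (g 0) (g 1)
  where
  identity : ∀ a b → b + 0ℤ ≡ 0ℤ * a + (0ℤ + 1ℤ - 0ℤ) * b
  identity = solve-∀
∑-insertions-min g prev v (y ∷ ys) v<prev (v<y ∷ v<ys) = begin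
    ∑[ u ∈ insertions v (y ∷ ys) ] g (desFrom prev u)
  ≡⟨ ∑-insertions-∷ v y ys (g ∘ desFrom prev) ⟩
    g (desFrom prev (v ∷ y ∷ ys)) + ∑[ u ∈ insertions v ys ] g (descentStep β (desFrom y u))
  ≡⟨ cong₂ _+_ (cong g new-descent) (∑-insertions-min (g ∘ descentStep β) y v ys v<y v<ys) ⟩
    g (suc d) + minInsertion (length ys) (g ∘ descentStep β) d
  ≡⟨ minInsertion-∷ β g (length ys) d ⟩
    minInsertion (suc (length ys)) g (descentStep β d) ∎
  where
  β = ⌊ y <? prev ⌋
  d = desFrom y ys
  new-descent : desFrom prev (v ∷ y ∷ ys) ≡ suc d
  new-descent rewrite ⌊⌋-true (v <? prev) v<prev | ⌊⌋-false (y <? v) (ℤ.<-asym v<y) = refl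

-- The 0-based letter x stands for |σᵢ| = x+1, negative exactly when x+1 ≤ j.
signed : ℕ → ℕ → ℤ
signed j x = if suc x ≤ᵇ j then -[1+ x ] else + suc x

signed-neg : ∀ {j x} → x < j → signed j x ≡ -[1+ x ]
signed-neg {j} {x} x<j with suc x ≤ᵇ j | ℕ.≤⇒≤ᵇ x<j
... | true | _ = refl

signed-pos : ∀ {j x} → j ≤ x → signed j x ≡ + suc x
signed-pos {j} {x} j≤x with suc x ≤ᵇ j in eq
... | true  = ⊥-elim (ℕ.<⇒≱ (ℕ.≤ᵇ⇒≤ (suc x) j (subst T (sym eq) _)) j≤x)
... | false = refl

desWeight : ℕ → ℕ → (ℕ → ℤ) → ℤ
desWeight n j g = ∑[ p ∈ perms (upTo n) ] g (des (map (signed j) p))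

∑-perms-upTo-cong : ∀ n {f g : List ℕ → ℤ} → (∀ p → All (_< n) p → length p ≡ n → f p ≡ g p) →
                    ∑ (perms (upTo n)) f ≡ ∑ (perms (upTo n)) g
∑-perms-upTo-cong n f≡g = ∑-congᴬ (All.map
  (λ {p} p↭ → f≡g p (All-resp-↭ (↭-sym p↭) (applyUpTo⁺₁ (λ i → i) n (λ i<n → i<n))) (trans (↭-length p↭) (length-upTo n)))
  (perms-↭ (upTo n)))

desWeight-cong : ∀ n j {g h : ℕ → ℤ} → (∀ d → g d ≡ h d) → desWeight n j g ≡ desWeight n j h
desWeight-cong n j g≡h = ∑-cong (λ p → g≡h (des (map (signed j) p))) (perms (upTo n))

desWeight-- : ∀ n j g h → desWeight n j (λ d → g d - h d) ≡ desWeight n j g - desWeight n j h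
desWeight-- n j g h = ∑-- (perms (upTo n)) (g ∘ des ∘ map (signed j)) (h ∘ des ∘ map (signed j))

desWeight-suc : ∀ m j g → desWeight (suc m) j g ≡
  ∑[ q ∈ perms (upTo m) ] ∑[ u ∈ insertions (signed j m) (map (signed j) q) ] g (des u)
desWeight-suc m j g = begin
    ∑ (perms (upTo (suc m))) G
  ≡⟨ cong (λ l → ∑ (perms l) G) (sym (upTo-∷ʳ m)) ⟩
    ∑ (perms (upTo m ∷ʳ m)) G
  ≡⟨ ∑-perms-∷ʳ (upTo m) m G ⟩
    ∑ (perms (m ∷ upTo m)) G
  ≡⟨ ∑-concatMap (insertions m) (perms (upTo m)) G ⟩
    ∑[ q ∈ perms (upTo m) ] ∑ (insertions m q) G
  ≡⟨ ∑-cong (λ q → sym (signing-commutes q)) (perms (upTo m)) ⟩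
    ∑[ q ∈ perms (upTo m) ] ∑[ u ∈ insertions (signed j m) (map (signed j) q) ] g (des u) ∎
  where
  G : List ℕ → ℤ
  G p = g (des (map (signed j) p))
  signing-commutes : ∀ q → ∑[ u ∈ insertions (signed j m) (map (signed j) q) ] g (des u) ≡ ∑ (insertions m q) G
  signing-commutes q = trans (cong (λ us → ∑ us (g ∘ des)) (insertions-map (signed j) m q))
                             (∑-map (map (signed j)) (insertions m q) (g ∘ des))

desWeight-insert-max : ∀ {m j} → j ≤ m → ∀ g → desWeight (suc m) j g ≡ desWeight m j (maxInsertion m g)
desWeight-insert-max {m} {j} j≤m g =
  trans (desWeight-suc m j g) (∑-perms-upTo-cong m insert)
  where
  below-top : ∀ {x} → x < m → signed j x ℤ.< + suc m
  below-top {x} x<m with suc x ≤ᵇ j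
  ... | true  = ℤ.-<+
  ... | false = ℤ.+<+ (s≤s x<m)
  insert : ∀ q → All (_< m) q → length q ≡ m →
    ∑[ u ∈ insertions (signed j m) (map (signed j) q) ] g (des u) ≡ maxInsertion m g (des (map (signed j) q))
  insert q q<m len = begin
      ∑[ u ∈ insertions (signed j m) (map (signed j) q) ] g (des u)
    ≡⟨ cong (λ v → ∑[ u ∈ insertions v (map (signed j) q) ] g (des u)) (signed-pos j≤m) ⟩
      ∑[ u ∈ insertions (+ suc m) (map (signed j) q) ] g (des u)
    ≡⟨ ∑-insertions-max g (+ 0) (+ suc m) (map (signed j) q) (ℤ.+<+ (s≤s z≤n)) (map⁺ (All.map below-top q<m)) ⟩
      maxInsertion (length (map (signed j) q)) g (des (map (signed j) q))
    ≡⟨ cong (λ L → maxInsertion L g (des (map (signed j) q))) (trans (length-map (signed j) q) len) ⟩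
      maxInsertion m g (des (map (signed j) q)) ∎

desWeight-insert-min : ∀ m g → desWeight (suc m) (suc m) g ≡ desWeight m m (minInsertion m g)
desWeight-insert-min m g =
  trans (desWeight-suc m (suc m) g) (∑-perms-upTo-cong m insert)
  where
  above-bottom : ∀ {x} → x < m → -[1+ m ] ℤ.< signed m x
  above-bottom x<m = subst (-[1+ m ] ℤ.<_) (sym (signed-neg x<m)) (ℤ.-<- x<m)
  same-signs : ∀ {x} → x < m → signed (suc m) x ≡ signed m x
  same-signs x<m = trans (signed-neg (ℕ.m≤n⇒m≤1+n x<m)) (sym (signed-neg x<m))
  insert : ∀ q → All (_< m) q → length q ≡ m →
    ∑[ u ∈ insertions (signed (suc m) m) (map (signed (suc m)) q) ] g (des u) ≡ minInsertion m g (des (map (signed m) q))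
  insert q q<m len = begin
      ∑[ u ∈ insertions (signed (suc m) m) (map (signed (suc m)) q) ] g (des u)
    ≡⟨ cong₂ (λ v w → ∑[ u ∈ insertions v w ] g (des u)) (signed-neg (ℕ.n<1+n m)) (map-cong-local (All.map same-signs q<m)) ⟩
      ∑[ u ∈ insertions -[1+ m ] (map (signed m) q) ] g (des u)
    ≡⟨ ∑-insertions-min g (+ 0) -[1+ m ] (map (signed m) q) ℤ.-<+ (map⁺ (All.map above-bottom q<m)) ⟩
      minInsertion (length (map (signed m) q)) g (des (map (signed m) q))
    ≡⟨ cong (λ L → minInsertion L g (des (map (signed m) q))) (trans (length-map (signed m) q) len) ⟩
      minInsertion m g (des (map (signed m) q)) ∎

Δ : (ℕ → ℤ) → ℕ → ℤ
Δ g d = g d - g (suc d)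

maxInsertion-minInsertion : ∀ L g d → maxInsertion L g d - minInsertion L g d ≡ Δ g d
maxInsertion-minInsertion L g d = identity (+ d) (+ L) (g d) (g (suc d))
  where
  identity : ∀ d L a b → ((d + 1ℤ) * a + (L - d) * b) - (d * a + (L + 1ℤ - d) * b) ≡ a - b
  identity = solve-∀

Δ-maxInsertion : ∀ L g d → Δ (maxInsertion (suc L) g) d ≡ maxInsertion L (Δ g) d
Δ-maxInsertion L g d = identity (+ d) (+ L) (g d) (g (suc d)) (g (suc (suc d)))
  where
  identity : ∀ d L a b c →
    ((d + 1ℤ) * a + ((1ℤ + L) - d) * b) - (((1ℤ + d) + 1ℤ) * b + ((1ℤ + L) - (1ℤ + d)) * c)
      ≡ (d + 1ℤ) * (a - b) + (L - d) * (b - c)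
  identity = solve-∀

desWeight-threshold-Δ : ∀ {i m} → i ≤′ m → ∀ g →
  desWeight (suc m) i g - desWeight (suc m) (suc i) g ≡ desWeight m i (Δ g)
desWeight-threshold-Δ {m = m} ≤′-refl g = begin
    desWeight (suc m) m g - desWeight (suc m) (suc m) g
  ≡⟨ cong₂ _-_ (desWeight-insert-max (ℕ.≤-refl {m}) g) (desWeight-insert-min m g) ⟩
    desWeight m m (maxInsertion m g) - desWeight m m (minInsertion m g)
  ≡⟨ sym (desWeight-- m m (maxInsertion m g) (minInsertion m g)) ⟩
    desWeight m m (λ d → maxInsertion m g d - minInsertion m g d)
  ≡⟨ desWeight-cong m m (maxInsertion-minInsertion m g) ⟩
    desWeight m m (Δ g) ∎
desWeight-threshold-Δ {i} {suc m} (≤′-step i≤′m) g = begin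
    desWeight (suc (suc m)) i g - desWeight (suc (suc m)) (suc i) g
  ≡⟨ cong₂ _-_ (desWeight-insert-max (ℕ.m≤n⇒m≤1+n i≤m) g) (desWeight-insert-max (s≤s i≤m) g) ⟩
    desWeight (suc m) i (maxInsertion (suc m) g) - desWeight (suc m) (suc i) (maxInsertion (suc m) g)
  ≡⟨ desWeight-threshold-Δ i≤′m (maxInsertion (suc m) g) ⟩
    desWeight m i (Δ (maxInsertion (suc m) g))
  ≡⟨ desWeight-cong m i (Δ-maxInsertion m g) ⟩
    desWeight m i (maxInsertion m (Δ g))
  ≡⟨ sym (desWeight-insert-max i≤m (Δ g)) ⟩
    desWeight (suc m) i (Δ g) ∎
  where
  i≤m = ℕ.≤′⇒≤ i≤′m

𝟙 : Bool → ℤ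
𝟙 β = if β then 1ℤ else 0ℤ

𝟙-∧ : ∀ α β → 𝟙 (α ∧ β) ≡ (if β then 𝟙 α else 0ℤ)
𝟙-∧ true  true  = refl
𝟙-∧ true  false = refl
𝟙-∧ false true  = refl
𝟙-∧ false false = refl

length-filterᵇ : {A : Set} (P : A → Bool) (xs : List A) → + length (filterᵇ P xs) ≡ ∑[ x ∈ xs ] 𝟙 (P x)
length-filterᵇ P []       = refl
length-filterᵇ P (x ∷ xs) with P x
... | true  = cong (_+_ 1ℤ) (length-filterᵇ P xs)
... | false = trans (length-filterᵇ P xs) (sym (ℤ.+-identityˡ _))

sign-choice : ∀ β α x (f : ℤ → ℤ) →
  (if not β ∧ α then f (+ suc x) else 0ℤ) + ((if β ∧ α then f -[1+ x ] else 0ℤ) + 0ℤ)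
    ≡ (if α then f (if β then -[1+ x ] else + suc x) else 0ℤ)
sign-choice false α x f = ℤ.+-identityʳ _
sign-choice true  α x f = trans (ℤ.+-identityˡ _) (ℤ.+-identityʳ _)

∑-signVecs : ∀ j (p : List ℕ) (f : List ℤ → ℤ) →
  ∑[ v ∈ signVecs (length p) ] (if allB (negIffLe j) (applySigns (map suc p) v) then f (applySigns (map suc p) v) else 0ℤ)
    ≡ f (map (signed j) p)
∑-signVecs j []      f = ℤ.+-identityʳ (f [])
∑-signVecs j (x ∷ p) f = begin
    ∑ (concatMap (λ v → (false ∷ v) ∷ (true ∷ v) ∷ []) (signVecs (length p))) F
  ≡⟨ ∑-concatMap (λ v → (false ∷ v) ∷ (true ∷ v) ∷ []) (signVecs (length p)) F ⟩
    ∑[ v ∈ signVecs (length p) ] (F (false ∷ v) + (F (true ∷ v) + 0ℤ))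
  ≡⟨ ∑-cong (λ v → sign-choice (suc x ≤ᵇ j) (allB (negIffLe j) (w v)) x (λ s → f (s ∷ w v))) (signVecs (length p)) ⟩
    ∑[ v ∈ signVecs (length p) ] (if allB (negIffLe j) (w v) then f (signed j x ∷ w v) else 0ℤ)
  ≡⟨ ∑-signVecs j p (f ∘ (signed j x ∷_)) ⟩
    f (map (signed j) (x ∷ p)) ∎
  where
  F : List Bool → ℤ
  F v = if allB (negIffLe j) (applySigns (map suc (x ∷ p)) v) then f (applySigns (map suc (x ∷ p)) v) else 0ℤ
  w : List Bool → List ℤ
  w = applySigns (map suc p)

indicator : ℕ → ℕ → ℤ
indicator k d = 𝟙 (d ≡ᵇ k)

count-as-desWeight : ∀ n k j →
  + length (filterᵇ (λ σ → (des σ ≡ᵇ k) ∧ allB (negIffLe j) σ) (signedPerms n)) ≡ desWeight n j (indicator k)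
count-as-desWeight n k j = begin
    + length (filterᵇ P (signedPerms n))
  ≡⟨ length-filterᵇ P (signedPerms n) ⟩
    ∑ (signedPerms n) (𝟙 ∘ P)
  ≡⟨ ∑-concatMap signings (perms (map suc (upTo n))) (𝟙 ∘ P) ⟩
    ∑[ p ∈ perms (map suc (upTo n)) ] ∑ (signings p) (𝟙 ∘ P)
  ≡⟨ cong (λ ps → ∑[ p ∈ ps ] ∑ (signings p) (𝟙 ∘ P)) (perms-map suc (upTo n)) ⟩
    ∑[ p ∈ map (map suc) (perms (upTo n)) ] ∑ (signings p) (𝟙 ∘ P)
  ≡⟨ ∑-map (map suc) (perms (upTo n)) (λ p → ∑ (signings p) (𝟙 ∘ P)) ⟩
    ∑[ p ∈ perms (upTo n) ] ∑ (signings (map suc p)) (𝟙 ∘ P)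
  ≡⟨ ∑-perms-upTo-cong n one-signing ⟩
    desWeight n j (indicator k) ∎
  where
  P : List ℤ → Bool
  P σ = (des σ ≡ᵇ k) ∧ allB (negIffLe j) σ
  signings : List ℕ → List (List ℤ)
  signings p = map (applySigns p) (signVecs n)
  one-signing : ∀ p → All (_< n) p → length p ≡ n → ∑ (signings (map suc p)) (𝟙 ∘ P) ≡ indicator k (des (map (signed j) p))
  one-signing p _ refl = begin
      ∑ (signings (map suc p)) (𝟙 ∘ P)
    ≡⟨ ∑-map (applySigns (map suc p)) (signVecs (length p)) (𝟙 ∘ P) ⟩
      ∑[ v ∈ signVecs (length p) ] 𝟙 (P (applySigns (map suc p) v))
    ≡⟨ ∑-cong (λ v → 𝟙-∧ (des (applySigns (map suc p) v) ≡ᵇ k) (allB (negIffLe j) (applySigns (map suc p) v))) (signVecs (length p)) ⟩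
      _
    ≡⟨ ∑-signVecs j p (λ σ → indicator k (des σ)) ⟩
      indicator k (des (map (signed j) p)) ∎

desWeight-indicator-vanishes : ∀ {n k} j → n < k → desWeight n j (indicator k) ≡ 0ℤ
desWeight-indicator-vanishes {n} {k} j n<k =
  trans (∑-perms-upTo-cong n too-few-letters) (∑-zero (perms (upTo n)))
  where
  too-few-letters : ∀ p → All (_< n) p → length p ≡ n → indicator k (des (map (signed j) p)) ≡ 0ℤ
  too-few-letters p _ len with des (map (signed j) p) ≡ᵇ k in eq
  ... | true  = ⊥-elim (ℕ.<-irrefl (ℕ.≡ᵇ⇒≡ _ k (subst T (sym eq) _)) (ℕ.≤-<-trans des≤n n<k))
    where
    des≤n : des (map (signed j) p) ≤ n
    des≤n = subst (des (map (signed j) p) ≤_) (trans (length-map (signed j) p) len) (desFrom≤length (+ 0) (map (signed j) p))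
  ... | false = refl

b-as-desWeight : ∀ {n j} k → j ≤ n → + b n k j ≡ desWeight n j (indicator k)
b-as-desWeight {n} {j} k j≤n with j ≤ᵇ n | ℕ.≤⇒≤ᵇ j≤n | k ≤ᵇ n in k≤ᵇn
... | true | _ | true  = count-as-desWeight n k j
... | true | _ | false = sym (desWeight-indicator-vanishes {n} {k} j (ℕ.≰⇒> (λ k≤n → subst T k≤ᵇn (ℕ.≤⇒≤ᵇ k≤n))))

corollary5p1 : (n j k : ℕ) → 1 ≤ n → 1 ≤ j → j ≤ n → 1 ≤ k → k ≤ n →
    (+ b n k (j ∸ 1)) - (+ b n k j) ≡ (+ b (n ∸ 1) k (j ∸ 1)) - (+ b (n ∸ 1) (k ∸ 1) (j ∸ 1))
corollary5p1 (suc m) (suc i) (suc k) _ _ (s≤s i≤m) _ _ = begin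
    + b (suc m) (suc k) i - + b (suc m) (suc k) (suc i)
  ≡⟨ cong₂ _-_ (b-as-desWeight (suc k) (ℕ.m≤n⇒m≤1+n i≤m)) (b-as-desWeight (suc k) (s≤s i≤m)) ⟩
    desWeight (suc m) i (indicator (suc k)) - desWeight (suc m) (suc i) (indicator (suc k))
  ≡⟨ desWeight-threshold-Δ (ℕ.≤⇒≤′ i≤m) (indicator (suc k)) ⟩   -- Δ (indicator (suc k)) reduces to this
    desWeight m i (λ d → indicator (suc k) d - indicator k d)
  ≡⟨ desWeight-- m i (indicator (suc k)) (indicator k) ⟩
    desWeight m i (indicator (suc k)) - desWeight m i (indicator k)
  ≡⟨ sym (cong₂ _-_ (b-as-desWeight (suc k) i≤m) (b-as-desWeight k i≤m)) ⟩
    + b m (suc k) i - + b m k i ∎
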